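{- Let $m>1$ be an integer such that there is a unique minimal triple $(a,b,c)$. Then either $c=3ab$, or $a=b$ and $c=3a^2+a$.
   Context: An $m$-Markoff triple is a triple $(a,b,c)$ of positive integers with $a^2+b^2+c^2=3abc+m$. A minimal triple is an $m$-Markoff triple $(a,b,c)$ with $a\le b\le c$ and $3ab-c\le 0$. -}

module Defs where

open import Data.Nat using (ℕ; _+_; _*_; _≤_; _<_)
open import Data.Product using (_×_)
open import Relation.Binary.PropositionalEquality using (_≡_)

MarkoffTriple : ℕ → ℕ → ℕ → ℕ → Set
MarkoffTriple m a b c =
  (0 < a) × (0 < b) × (0 < c) ×
  (a * a + b * b + c * c ≡ 3 * a * b * c + m)

-- minimal triple: m-Markoff triple with a ≤ b ≤ c and 3ab - c ≤ 0, i.e. 3ab ≤ c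
MinimalTriple : ℕ → ℕ → ℕ → ℕ → Set
MinimalTriple m a b c =
  MarkoffTriple m a b c × (a ≤ b) × (b ≤ c) × (3 * a * b ≤ c)

{-# OPTIONS --safe #-}
module Submission where

-- Write c = 3ab + d.  Then (a, b, d) is a zero of the symmetric form
-- x² + y² + z² + 3xyz − m, and conversely every zero (x, y, z) with
-- 0 < x ≤ y and 0 < z lifts to the minimal triple (x, y, 3xy + z).
-- If d > 0, reordering (a, b, d) in the admissible ways produces minimal
-- triples which by uniqueness all equal (a, b, c); this forces a = b = d.

open import Defs
open import Data.Nat using (ℕ; zero; suc; _+_; _*_; _<_; _≤_; z<s)
open import Data.Nat.Properties
  using (+-cancelˡ-≡; +-identityʳ; m≤n⇒∃[o]m+o≡n; m≤m+n; m≤n+m; m≤n*m; ≤-trans; ≤-reflexive; <⇒≤; <-≤-trans; <-irrefl; ≤-<-connex)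
open import Data.Nat.Tactic.RingSolver using (solve-∀)
open import Data.Product using (_×_; _,_; proj₁; proj₂; ∃-syntax)
open import Data.Sum using (_⊎_; inj₁; inj₂)
open import Data.Empty using (⊥-elim)
open import Relation.Binary.PropositionalEquality using (_≡_; refl; sym; trans)

markoffForm : ℕ → ℕ → ℕ → ℕ
markoffForm x y z = x * x + y * y + z * z + 3 * x * y * z

-- The ring solver does not unfold markoffForm, hence the restated identities.
markoffForm-comm₁₃ : ∀ x y z → markoffForm x y z ≡ markoffForm z y x
markoffForm-comm₁₃ = comm
  where
  comm : ∀ x y z → x * x + y * y + z * z + 3 * x * y * z ≡ z * z + y * y + x * x + 3 * z * y * x
  comm = solve-∀

markoffForm-comm₂₃ : ∀ x y z → markoffForm x y z ≡ markoffForm x z y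
markoffForm-comm₂₃ = comm
  where
  comm : ∀ x y z → x * x + y * y + z * z + 3 * x * y * z ≡ x * x + z * z + y * y + 3 * x * z * y
  comm = solve-∀

markoffForm-shift : ∀ x y z →
  x * x + y * y + (3 * x * y + z) * (3 * x * y + z) ≡ 3 * x * y * (3 * x * y + z) + markoffForm x y z
markoffForm-shift = shift
  where
  shift : ∀ x y z → x * x + y * y + (3 * x * y + z) * (3 * x * y + z)
                  ≡ 3 * x * y * (3 * x * y + z) + (x * x + y * y + z * z + 3 * x * y * z)
  shift = solve-∀

UniqueMinimalTriple : ℕ → ℕ → ℕ → ℕ → Set
UniqueMinimalTriple m a b c =
  (a′ b′ c′ : ℕ) → MinimalTriple m a′ b′ c′ → (a′ ≡ a) × (b′ ≡ b) × (c′ ≡ c)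

y≤3*x*y : ∀ x y → 0 < x → y ≤ 3 * x * y
y≤3*x*y (suc x) y _ = m≤n*m y (3 * suc x)

minimalTriple-lift : ∀ {m x y z} → 0 < x → 0 < y → 0 < z → x ≤ y →
  markoffForm x y z ≡ m → MinimalTriple m x y (3 * x * y + z)
minimalTriple-lift {x = x} {y} {z} 0<x 0<y 0<z x≤y refl =
  (0<x , 0<y , ≤-trans 0<z (m≤n+m z _) , markoffForm-shift x y z) ,
  x≤y , ≤-trans (y≤3*x*y x y 0<x) (m≤m+n _ z) , m≤m+n _ z

minimalTriple-descent : ∀ {m a b c} → MinimalTriple m a b c →
  ∃[ d ] (3 * a * b + d ≡ c) × (markoffForm a b d ≡ m)
minimalTriple-descent {a = a} {b} ((_ , _ , _ , markoff) , _ , _ , 3ab≤c)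
  with m≤n⇒∃[o]m+o≡n 3ab≤c
... | d , refl = d , refl , +-cancelˡ-≡ (3 * a * b * (3 * a * b + d)) _ _
                              (trans (sym (markoffForm-shift a b d)) markoff)

uniqueMinimalTriple⇒a≡d×b≡d : ∀ {m a b c d} → UniqueMinimalTriple m a b c →
  0 < a → 0 < b → 0 < d → a ≤ b → markoffForm a b d ≡ m → (a ≡ d) × (b ≡ d)
uniqueMinimalTriple⇒a≡d×b≡d {a = a} {b} {d = d} unique 0<a 0<b 0<d a≤b form≡m =
  conclude (≤-<-connex a d)
  where
  d≡a : d ≤ b → d ≡ a
  d≡a d≤b = proj₁ (unique d b _ (minimalTriple-lift 0<d 0<b 0<a d≤b
              (trans (sym (markoffForm-comm₁₃ a b d)) form≡m)))
  d≡b : a ≤ d → d ≡ b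
  d≡b a≤d = proj₁ (proj₂ (unique a d _ (minimalTriple-lift 0<a 0<d 0<b a≤d
              (trans (sym (markoffForm-comm₂₃ a b d)) form≡m))))
  conclude : a ≤ d ⊎ d < a → (a ≡ d) × (b ≡ d)
  conclude (inj₁ a≤d) = sym (d≡a (≤-reflexive (d≡b a≤d))) , sym (d≡b a≤d)
  conclude (inj₂ d<a) = ⊥-elim (<-irrefl (d≡a (<⇒≤ (<-≤-trans d<a a≤b))) d<a)

proposition5p1 : (m a b c : ℕ) → 1 < m →
    MinimalTriple m a b c →
    ((a′ b′ c′ : ℕ) → MinimalTriple m a′ b′ c′ → (a′ ≡ a) × (b′ ≡ b) × (c′ ≡ c)) →
    (c ≡ 3 * a * b) ⊎ ((a ≡ b) × (c ≡ 3 * a * a + a))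
proposition5p1 m a b c _ minimal@((0<a , 0<b , _ , _) , a≤b , _ , _) unique
  with minimalTriple-descent minimal
... | zero , 3ab+0≡c , _ = inj₁ (trans (sym 3ab+0≡c) (+-identityʳ _))
... | suc d , 3ab+d≡c , form≡m
  with uniqueMinimalTriple⇒a≡d×b≡d unique 0<a 0<b z<s a≤b form≡m
... | refl , refl = inj₂ (refl , sym 3ab+d≡c)
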